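{- Let $n>2$. The join-irreducible elements of the lattice $(\mathfrak{C}(n)_\bot,\sqsubseteq)$ are the atoms $(\{i\},\pi^\bot)$, $i\in N$, and the elements $(\{i\},\pi^\bot_{jk})$ with $i,j,k\in N$, $j\ne k$, $i\notin\{j,k\}$. Its meet-irreducible elements are the elements $(S,\pi)$ where $\pi$ is any $2$-partition (these are the co-atoms).
   Context: Let $N=\{1,\dots,n\}$, $\Pi(n)$ the lattice of partitions of $N$ ordered by refinement, $\pi^\bot=\{\{1\},\dots,\{n\}\}$, and for distinct $j,k$, $\pi^\bot_{jk}$ the partition whose blocks are $\{j,k\}$ and the singletons $\{l\}$, $l\notin\{j,k\}$. An embedded subset is a pair $(S,\pi)$ with $S\subseteq N$ nonempty and $\pi\in\Pi(n)$ having $S$ as a block. $\mathfrak{C}(n)_\bot$ is the set of embedded subsets together with an added least element $\bot$, ordered by $(S,\pi)\sqsubseteq(S',\pi')$ iff $S\subseteq S'$ and $\pi$ refines $\pi'$; it is a lattice with top $(N,\{N\})$. A join-irreducible (meet-irreducible) element is one covering (covered by) exactly one element. A $2$-partition is a partition with two blocks. -}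

module Defs where

open import Data.Nat using (ℕ)
open import Data.Bool using (Bool; true; false; _∨_; if_then_else_)
open import Data.Fin using (Fin; _≟_)
open import Data.Fin.Subset using (Subset; ⁅_⁆; _∪_; _⊆_; _∈_; _∉_; Nonempty)
open import Data.Vec using (Vec; lookup; tabulate)
open import Data.Product using (Σ; _×_; ∃; ∃-syntax)
open import Data.Sum using (_⊎_)
open import Data.Empty using (⊥)
open import Data.Unit using (⊤)
open import Relation.Nullary using (¬_; does)
open import Relation.Binary.PropositionalEquality using (_≡_; _≢_)

-- N = Fin n.  A binary relation on N is stored as its "row" table:
-- row i is the set of elements related to i (i.e. the block of i).
-- This representation is canonical, so _≡_ on it is the right equality.
Rel : ℕ → Set
Rel n = Vec (Subset n) n

_∼[_]_ : ∀ {n} → Fin n → Rel n → Fin n → Set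
i ∼[ R ] j = j ∈ lookup R i

-- A partition of N = an equivalence relation on N (blocks = classes).
record IsPartition {n : ℕ} (R : Rel n) : Set where
  field
    refl′  : ∀ i → i ∼[ R ] i
    sym′   : ∀ i j → i ∼[ R ] j → j ∼[ R ] i
    trans′ : ∀ i j k → i ∼[ R ] j → j ∼[ R ] k → i ∼[ R ] k

IsBlock : ∀ {n} → Subset n → Rel n → Set
IsBlock {n} S R = ∃[ i ] (lookup R i ≡ S)

Refines : ∀ {n} → Rel n → Rel n → Set
Refines R R′ = ∀ i j → i ∼[ R ] j → i ∼[ R′ ] j

discrete : ∀ {n} → Rel n
discrete = tabulate ⁅_⁆

pairPart : ∀ {n} → Fin n → Fin n → Rel n
pairPart j k = tabulate λ l →
  if does (l ≟ j) ∨ does (l ≟ k) then ⁅ j ⁆ ∪ ⁅ k ⁆ else ⁅ l ⁆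

-- 2-partition: exactly two blocks, i.e. there are i, j in different blocks
-- and every element lies in the block of i or the block of j.
TwoPartition : ∀ {n} → Rel n → Set
TwoPartition R = ∃[ i ] ∃[ j ] (¬ (i ∼[ R ] j) × (∀ k → (k ∼[ R ] i) ⊎ (k ∼[ R ] j)))

data Elem (n : ℕ) : Set where
  bot : Elem n
  emb : (S : Subset n) → Nonempty S → (R : Rel n) → IsPartition R → IsBlock S R → Elem n

_⊑_ : ∀ {n} → Elem n → Elem n → Set
bot ⊑ y = ⊤
emb S _ R _ _ ⊑ bot = ⊥
emb S _ R _ _ ⊑ emb S′ _ R′ _ _ = (S ⊆ S′) × Refines R R′

_≈_ : ∀ {n} → Elem n → Elem n → Set
x ≈ y = (x ⊑ y) × (y ⊑ x)

_⊏_ : ∀ {n} → Elem n → Elem n → Set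
x ⊏ y = (x ⊑ y) × ¬ (y ⊑ x)

_⋖_ : ∀ {n} → Elem n → Elem n → Set
x ⋖ y = (x ⊏ y) × (∀ z → x ⊏ z → z ⊏ y → ⊥)

JoinIrreducible : ∀ {n} → Elem n → Set
JoinIrreducible {n} x = Σ (Elem n) λ y → (y ⋖ x) × (∀ y′ → y′ ⋖ x → y′ ≈ y)

MeetIrreducible : ∀ {n} → Elem n → Set
MeetIrreducible {n} x = Σ (Elem n) λ y → (x ⋖ y) × (∀ y′ → x ⋖ y′ → y′ ≈ y)

IsAtomForm : ∀ {n} → Elem n → Set
IsAtomForm bot = ⊥
IsAtomForm (emb S _ R _ _) = ∃[ i ] ((S ≡ ⁅ i ⁆) × (R ≡ discrete))

IsPairForm : ∀ {n} → Elem n → Set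
IsPairForm bot = ⊥
IsPairForm (emb S _ R _ _) = ∃[ i ] ∃[ j ] ∃[ k ]
  ((j ≢ k) × (i ≢ j) × (i ≢ k) × (S ≡ ⁅ i ⁆) × (R ≡ pairPart j k))

IsTwoPartForm : ∀ {n} → Elem n → Set
IsTwoPartForm bot = ⊥
IsTwoPartForm (emb S _ R _ _) = TwoPartition R

module Submission where

-- In a finite poset, x is join-irreducible iff there is a greatest element strictly below x, and
-- meet-irreducible iff there is a least element strictly above x; existence of covers comes from
-- a strictly monotone measure.
--
-- Let x = (S, π) and b ∈ S. Every atom ({a}, π^⊥) with a ∈ S is below x, so if x is not an atom,
-- the greatest element y below x has a set containing S; as x ⋢ y, y separates some i ∼π j,
-- and then i, j ∉ S. Then ({b}, π^⊥_{ij}) ⊑ x is not below y, so it is x. Conversely π^⊥_{jk} is an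
-- atom of Π(n), so ({i}, π^⊥) is the greatest element below ({i}, π^⊥_{jk}).
--
-- If π has a third block besides S and the block of some t ∉ S, then x is the meet of the
-- elements (S, {S, ∁S}) and (∁[a], {∁[a], [a]}), a ∉ S, all strictly above x, so x has no least
-- element above it. Conversely a 2-partition is a co-atom of Π(n), so the top is the least
-- element above (S, π).

open import Defs
open import Data.Nat as ℕ using (ℕ; _<_; _≤_; _+_; z≤n; s≤s)
open import Data.Nat.Properties
  using ( +-mono-≤; +-mono-<-≤; +-mono-≤-<; +-monoʳ-≤; +-suc; <⇒≱; m≤m+n; ≤-pred; ≤-trans
        ; <-trans; n<1+n; module ≤-Reasoning )
open import Data.Product as Prod using (_×_; _,_; proj₁; proj₂; ∃₂; ∃-syntax)
open import Data.Sum as Sum using (_⊎_; inj₁; inj₂)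
open import Data.Bool using (_∨_; if_then_else_)
open import Data.Unit using (tt)
open import Data.Empty using (⊥-elim)
open import Data.Fin as Fin using (Fin; _≟_)
open import Data.Fin.Subset using (Subset; ⁅_⁆; _∪_; _⊆_; _∈_; _∉_; Nonempty; ∣_∣; ∁; ⊤)
open import Data.Fin.Subset.Properties
  using ( _∈?_; _⊆?_; ⊆-antisym; ∈⊤; x∈⁅x⁆; x∈⁅y⁆⇒x≡y; x∈p∪q⁻; x∈p∪q⁺
        ; x∈∁p⇒x∉p; x∉∁p⇒x∈p; x∉p⇒x∈∁p; p⊆q⇒∣p∣≤∣q∣; p⊂q⇒∣p∣<∣q∣ )
open import Data.Fin.Properties using (¬∀⟶∃¬; all?)
open import Data.Vec using (Vec; []; _∷_; lookup; tabulate; map; sum)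
open import Data.Vec.Properties using (lookup∘tabulate; tabulate∘lookup; tabulate-cong)
open import Function using (_∘_; _⇔_; mk⇔; Equivalence)
open import Function.Properties.Equivalence using (⇔-isEquivalence)
open import Relation.Binary.Structures using (IsEquivalence)
import Relation.Binary.Construct.On as On
open import Relation.Nullary using (¬_; Dec; yes; no; does; contradiction)
open import Relation.Nullary.Decidable using (map′; _⊎-dec_; _→-dec_; decidable-stable)
open import Relation.Binary.PropositionalEquality as ≡ using (_≡_; _≢_; refl; sym; trans; subst)

open Equivalence using (to; from)

private
  variable
    n : ℕ

⊈⇒∃∉ : {p q : Subset n} → ¬ (p ⊆ q) → ∃[ x ] (x ∈ p × x ∉ q)
⊈⇒∃∉ {n} {p} {q} p⊈q
  with ¬∀⟶∃¬ n (λ x → x ∈ p → x ∈ q) (λ x → (x ∈? p) →-dec (x ∈? q)) (λ p⊆q → p⊈q (p⊆q _))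
... | x , x∈p⇏x∈q with x ∈? p
...   | yes x∈p = x , x∈p , x∈p⇏x∈q ∘ λ x∈q _ → x∈q
...   | no x∉p  = contradiction (λ x∈p → contradiction x∈p x∉p) x∈p⇏x∈q

⊆∧⊈⇒∣∣< : {p q : Subset n} → p ⊆ q → ¬ (q ⊆ p) → ∣ p ∣ < ∣ q ∣
⊆∧⊈⇒∣∣< p⊆q q⊈p with ⊈⇒∃∉ q⊈p
... | x , x∈q , x∉p = p⊂q⇒∣p∣<∣q∣ (p⊆q , x , x∈q , x∉p)

-- Partitions

refines? : (R R′ : Rel n) → Dec (Refines R R′)
refines? R R′ =
  map′ to-refines (λ R⊑R′ i → R⊑R′ i _) (all? λ i → lookup R i ⊆? lookup R′ i)
  where
  to-refines : (∀ i → lookup R i ⊆ lookup R′ i) → Refines R R′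
  to-refines rows⊆ i j = rows⊆ i

refines-antisym : {R R′ : Rel n} → Refines R R′ → Refines R′ R → R ≡ R′
refines-antisym {R = R} {R′} R⊑R′ R′⊑R = begin
  R                     ≡⟨ sym (tabulate∘lookup R) ⟩
  tabulate (lookup R)   ≡⟨ tabulate-cong (λ i → ⊆-antisym (R⊑R′ i _) (R′⊑R i _)) ⟩
  tabulate (lookup R′)  ≡⟨ tabulate∘lookup R′ ⟩
  R′                    ∎
  where open ≡.≡-Reasoning

¬refines⇒∃ : {R R′ : Rel n} → ¬ Refines R R′ →
             ∃₂ λ i j → i ∼[ R ] j × ¬ (i ∼[ R′ ] j)
¬refines⇒∃ {n} {R} {R′} R⋢R′
  with ¬∀⟶∃¬ n (λ i → lookup R i ⊆ lookup R′ i) (λ i → lookup R i ⊆? lookup R′ i)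
             (λ rows⊆ → R⋢R′ λ i j → rows⊆ i)
... | i , row⊈ with ⊈⇒∃∉ row⊈
...   | j , i∼j , i≁′j = i , j , i∼j , i≁′j

isPartition-⇔ : {R : Rel n} {_≈_ : Fin n → Fin n → Set} → IsEquivalence _≈_ →
                (∀ {i j} → i ∼[ R ] j ⇔ i ≈ j) → IsPartition R
isPartition-⇔ ≈-equiv ∼⇔≈ = record
  { refl′  = λ i → from ∼⇔≈ ≈-refl
  ; sym′   = λ i j i∼j → from ∼⇔≈ (≈-sym (to ∼⇔≈ i∼j))
  ; trans′ = λ i j k i∼j j∼k → from ∼⇔≈ (≈-trans (to ∼⇔≈ i∼j) (to ∼⇔≈ j∼k))
  }
  where open IsEquivalence ≈-equiv renaming (refl to ≈-refl; sym to ≈-sym; trans to ≈-trans)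

Saturated : Rel n → Subset n → Set
Saturated R A = ∀ {c d} → c ∼[ R ] d → c ∈ A → d ∈ A

module _ {R : Rel n} (P : IsPartition R) where
  open IsPartition P

  block-related : {S : Subset n} → IsBlock S R → ∀ {a b} → a ∈ S → b ∈ S → a ∼[ R ] b
  block-related (c , refl) {a} {b} c∼a c∼b = trans′ a c b (sym′ c a c∼a) c∼b

  block-saturated : {S : Subset n} → IsBlock S R → Saturated R S
  block-saturated (c , refl) {a} {b} a∼b c∼a = trans′ c a b c∼a a∼b

  ∁-block-saturated : (a : Fin n) → Saturated R (∁ (lookup R a))
  ∁-block-saturated a {c} {d} c∼d c∉[a] =
    x∉p⇒x∈∁p λ a∼d → x∈∁p⇒x∉p c∉[a] (trans′ a d c a∼d (sym′ c d c∼d))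

∼discrete⇔ : {i j : Fin n} → i ∼[ discrete ] j ⇔ i ≡ j
∼discrete⇔ {i = i} {j} = mk⇔
  (λ i∼j → sym (x∈⁅y⁆⇒x≡y i (subst (j ∈_) (lookup∘tabulate ⁅_⁆ i) i∼j)))
  (λ { refl → subst (i ∈_) (sym (lookup∘tabulate ⁅_⁆ i)) (x∈⁅x⁆ i) })

discrete-isPartition : IsPartition (discrete {n})
discrete-isPartition = isPartition-⇔ ≡.isEquivalence ∼discrete⇔

discrete-block : (i : Fin n) → IsBlock ⁅ i ⁆ discrete
discrete-block i = i , lookup∘tabulate ⁅_⁆ i

discrete-refines : {R : Rel n} → IsPartition R → Refines discrete R
discrete-refines P i j i∼j with to ∼discrete⇔ i∼j
... | refl = IsPartition.refl′ P i

indiscrete : Rel n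
indiscrete = tabulate λ _ → ⊤

∼indiscrete : (i j : Fin n) → i ∼[ indiscrete ] j
∼indiscrete i j = subst (j ∈_) (sym (lookup∘tabulate _ i)) ∈⊤

indiscrete-isPartition : IsPartition (indiscrete {n})
indiscrete-isPartition = record
  { refl′  = λ i → ∼indiscrete i i
  ; sym′   = λ i j _ → ∼indiscrete j i
  ; trans′ = λ i _ k _ _ → ∼indiscrete i k
  }

indiscrete-block : (i : Fin n) → IsBlock ⊤ indiscrete
indiscrete-block i = i , lookup∘tabulate _ i

InPair : Fin n → Fin n → Fin n → Set
InPair j k l = l ≡ j ⊎ l ≡ k

PairRel : Fin n → Fin n → Fin n → Fin n → Set
PairRel j k l b = l ≡ b ⊎ (InPair j k l × InPair j k b)

pairRel-isEquivalence : (j k : Fin n) → IsEquivalence (PairRel j k)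
pairRel-isEquivalence j k = record { refl = inj₁ refl ; sym = symmetric ; trans = transitive }
  where
  symmetric : ∀ {a b} → PairRel j k a b → PairRel j k b a
  symmetric (inj₁ a≡b)           = inj₁ (sym a≡b)
  symmetric (inj₂ (ja , jb))     = inj₂ (jb , ja)
  transitive : ∀ {a b c} → PairRel j k a b → PairRel j k b c → PairRel j k a c
  transitive (inj₁ refl) b∼c                = b∼c
  transitive a∼b@(inj₂ _) (inj₁ refl)       = a∼b
  transitive (inj₂ (ja , _)) (inj₂ (_ , jc)) = inj₂ (ja , jc)

pairPart-row-inPair : {j k l : Fin n} → InPair j k l → lookup (pairPart j k) l ≡ ⁅ j ⁆ ∪ ⁅ k ⁆
pairPart-row-inPair {j = j} {k} {l} l∈jk = trans (lookup∘tabulate _ l) (row l∈jk)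
  where
  row : InPair j k l →
        (if does (l ≟ j) ∨ does (l ≟ k) then ⁅ j ⁆ ∪ ⁅ k ⁆ else ⁅ l ⁆) ≡ ⁅ j ⁆ ∪ ⁅ k ⁆
  row l∈jk with l ≟ j | l ≟ k
  ... | yes _ | _     = refl
  ... | no _  | yes _ = refl
  ... | no l≢j | no l≢k with l∈jk
  ...   | inj₁ l≡j = contradiction l≡j l≢j
  ...   | inj₂ l≡k = contradiction l≡k l≢k

pairPart-row-outside : {j k l : Fin n} → ¬ InPair j k l → lookup (pairPart j k) l ≡ ⁅ l ⁆
pairPart-row-outside {j = j} {k} {l} l∉jk = trans (lookup∘tabulate _ l) row
  where
  row : (if does (l ≟ j) ∨ does (l ≟ k) then ⁅ j ⁆ ∪ ⁅ k ⁆ else ⁅ l ⁆) ≡ ⁅ l ⁆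
  row with l ≟ j | l ≟ k
  ... | yes l≡j | _       = contradiction (inj₁ l≡j) l∉jk
  ... | no _    | yes l≡k = contradiction (inj₂ l≡k) l∉jk
  ... | no _    | no _    = refl

∈⁅j⁆∪⁅k⁆⇔ : {j k b : Fin n} → b ∈ ⁅ j ⁆ ∪ ⁅ k ⁆ ⇔ InPair j k b
∈⁅j⁆∪⁅k⁆⇔ {j = j} {k} = mk⇔
  (λ b∈jk → Sum.map (x∈⁅y⁆⇒x≡y j) (x∈⁅y⁆⇒x≡y k) (x∈p∪q⁻ ⁅ j ⁆ ⁅ k ⁆ b∈jk))
  (λ { (inj₁ refl) → x∈p∪q⁺ (inj₁ (x∈⁅x⁆ j))
      ; (inj₂ refl) → x∈p∪q⁺ (inj₂ (x∈⁅x⁆ k)) })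

∼pairPart⇔ : {j k l b : Fin n} → l ∼[ pairPart j k ] b ⇔ PairRel j k l b
∼pairPart⇔ {j = j} {k} {l} {b} with (l ≟ j) ⊎-dec (l ≟ k)
... | yes l∈jk = mk⇔
  (λ l∼b → inj₂ (l∈jk , to ∈⁅j⁆∪⁅k⁆⇔ (subst (b ∈_) (pairPart-row-inPair l∈jk) l∼b)))
  (λ l≈b → subst (b ∈_) (sym (pairPart-row-inPair l∈jk)) (from ∈⁅j⁆∪⁅k⁆⇔ (b∈jk l≈b)))
  where
  b∈jk : PairRel j k l b → InPair j k b
  b∈jk (inj₁ refl)       = l∈jk
  b∈jk (inj₂ (_ , b∈jk)) = b∈jk
... | no l∉jk = mk⇔
  (λ l∼b → inj₁ (sym (x∈⁅y⁆⇒x≡y l (subst (b ∈_) (pairPart-row-outside l∉jk) l∼b))))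
  (λ { (inj₁ refl) → subst (l ∈_) (sym (pairPart-row-outside l∉jk)) (x∈⁅x⁆ l)
     ; (inj₂ (l∈jk , _)) → contradiction l∈jk l∉jk })

pairPart-isPartition : (j k : Fin n) → IsPartition (pairPart j k)
pairPart-isPartition j k = isPartition-⇔ (pairRel-isEquivalence j k) ∼pairPart⇔

pairPart-block : {j k l : Fin n} → l ≢ j → l ≢ k → IsBlock ⁅ l ⁆ (pairPart j k)
pairPart-block l≢j l≢k =
  _ , pairPart-row-outside λ { (inj₁ l≡j) → l≢j l≡j ; (inj₂ l≡k) → l≢k l≡k }

j∼pairPartk : (j k : Fin n) → j ∼[ pairPart j k ] k
j∼pairPartk j k = from ∼pairPart⇔ (inj₂ (inj₁ refl , inj₂ refl))

module _ {R : Rel n} (P : IsPartition R) {j k : Fin n} where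
  open IsPartition P

  pairPart-least : j ∼[ R ] k → Refines (pairPart j k) R
  pairPart-least j∼k a c a∼c with to ∼pairPart⇔ a∼c
  ... | inj₁ refl                    = refl′ a
  ... | inj₂ (inj₁ refl , inj₁ refl) = refl′ a
  ... | inj₂ (inj₁ refl , inj₂ refl) = j∼k
  ... | inj₂ (inj₂ refl , inj₁ refl) = sym′ j k j∼k
  ... | inj₂ (inj₂ refl , inj₂ refl) = refl′ a

  pairPart-atom : Refines R (pairPart j k) → Refines R discrete ⊎ Refines (pairPart j k) R
  pairPart-atom R⊑jk with j ∈? lookup R k
  ... | yes k∼j = inj₂ (pairPart-least (sym′ k j k∼j))
  ... | no k≁j  = inj₁ λ a c a∼c → from ∼discrete⇔ (≡-of a∼c (to ∼pairPart⇔ (R⊑jk a c a∼c)))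
    where
    ≡-of : ∀ {a c} → a ∼[ R ] c → PairRel j k a c → a ≡ c
    ≡-of _   (inj₁ a≡c)                    = a≡c
    ≡-of _   (inj₂ (inj₁ refl , inj₁ refl)) = refl
    ≡-of j∼k (inj₂ (inj₁ refl , inj₂ refl)) = contradiction (sym′ j k j∼k) k≁j
    ≡-of k∼j (inj₂ (inj₂ refl , inj₁ refl)) = contradiction k∼j k≁j
    ≡-of _   (inj₂ (inj₂ refl , inj₂ refl)) = refl

twoPart : Subset n → Rel n
twoPart A = tabulate λ l → if does (l ∈? A) then A else ∁ A

∼twoPart⇔ : {A : Subset n} {l b : Fin n} → l ∼[ twoPart A ] b ⇔ (l ∈ A ⇔ b ∈ A)
∼twoPart⇔ {A = A} {l} {b} with lookup∘tabulate (λ l → if does (l ∈? A) then A else ∁ A) l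
... | row with l ∈? A
...   | yes l∈A = mk⇔
  (λ l∼b → mk⇔ (λ _ → subst (b ∈_) row l∼b) (λ _ → l∈A))
  (λ l⇔b → subst (b ∈_) (sym row) (to l⇔b l∈A))
...   | no l∉A = mk⇔
  (λ l∼b → mk⇔ (λ l∈A → contradiction l∈A l∉A)
                (λ b∈A → contradiction b∈A (x∈∁p⇒x∉p (subst (b ∈_) row l∼b))))
  (λ l⇔b → subst (b ∈_) (sym row) (x∉p⇒x∈∁p (l∉A ∘ from l⇔b)))

twoPart-isPartition : (A : Subset n) → IsPartition (twoPart A)
twoPart-isPartition A = isPartition-⇔ (On.isEquivalence (_∈ A) ⇔-isEquivalence) ∼twoPart⇔

twoPart-block : {A : Subset n} {a : Fin n} → a ∈ A → IsBlock A (twoPart A)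
twoPart-block {A = A} a∈A = _ , ⊆-antisym
  (λ a∼b → to (to ∼twoPart⇔ a∼b) a∈A)
  (λ b∈A → from ∼twoPart⇔ (mk⇔ (λ _ → b∈A) (λ _ → a∈A)))

refines-twoPart : {R : Rel n} {A : Subset n} → IsPartition R → Saturated R A →
                  Refines R (twoPart A)
refines-twoPart P A-sat c d c∼d =
  from ∼twoPart⇔ (mk⇔ (A-sat c∼d) (A-sat (IsPartition.sym′ P c d c∼d)))

twoPartition-coatom : {R R′ : Rel n} → IsPartition R → IsPartition R′ → TwoPartition R →
                      Refines R R′ → Refines R′ R ⊎ (∀ a c → a ∼[ R′ ] c)
twoPartition-coatom {R = R} {R′} P P′ (i , j , i≁j , covered) R⊑R′ with j ∈? lookup R′ i
... | yes i∼′j = inj₂ λ a c → trans′ a i c (∼′i a) (sym′ c i (∼′i c))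
  where
  open IsPartition P′
  ∼′i : ∀ c → c ∼[ R′ ] i
  ∼′i c with covered c
  ... | inj₁ c∼i = R⊑R′ c i c∼i
  ... | inj₂ c∼j = trans′ c j i (R⊑R′ c j c∼j) (sym′ i j i∼′j)
... | no i≁′j = inj₁ R′⊑R
  where
  open IsPartition P
  open IsPartition P′ renaming (sym′ to sym″; trans′ to trans″)

  bridge : ∀ {a c} → a ∼[ R ] i → c ∼[ R ] j → a ∼[ R′ ] c → i ∼[ R′ ] j
  bridge {a} {c} a∼i c∼j a∼′c =
    trans″ i a j (sym″ a i (R⊑R′ a i a∼i)) (trans″ a c j a∼′c (R⊑R′ c j c∼j))

  R′⊑R : Refines R′ R
  R′⊑R a c a∼′c with covered a | covered c
  ... | inj₁ a∼i | inj₁ c∼i = trans′ a i c a∼i (sym′ c i c∼i)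
  ... | inj₂ a∼j | inj₂ c∼j = trans′ a j c a∼j (sym′ c j c∼j)
  ... | inj₁ a∼i | inj₂ c∼j = contradiction (bridge a∼i c∼j a∼′c) i≁′j
  ... | inj₂ a∼j | inj₁ c∼i = contradiction (bridge c∼i a∼j (sym″ a c a∼′c)) i≁′j

⊑-refl : (x : Elem n) → x ⊑ x
⊑-refl bot             = tt
⊑-refl (emb _ _ _ _ _) = (λ s → s) , (λ _ _ i∼j → i∼j)

⊑-trans : {x y z : Elem n} → x ⊑ y → y ⊑ z → x ⊑ z
⊑-trans {x = bot} _ _ = tt
⊑-trans {x = emb _ _ _ _ _} {emb _ _ _ _ _} {emb _ _ _ _ _}
        (S⊆S′ , R⊑R′) (S′⊆S″ , R′⊑R″) = S′⊆S″ ∘ S⊆S′ , λ i j → R′⊑R″ i j ∘ R⊑R′ i j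

_⊑?_ : (x y : Elem n) → Dec (x ⊑ y)
bot ⊑? _ = yes tt
emb _ _ _ _ _ ⊑? bot = no λ ()
emb S _ R _ _ ⊑? emb S′ _ R′ _ _ with S ⊆? S′ | refines? R R′
... | yes S⊆S′ | yes R⊑R′ = yes (S⊆S′ , R⊑R′)
... | no S⊈S′  | _         = no (S⊈S′ ∘ proj₁)
... | yes _    | no R⋢R′   = no (R⋢R′ ∘ proj₂)

¬⊏bot : {x : Elem n} → ¬ (x ⊏ bot)
¬⊏bot {x = bot}           (_ , bot⋢bot) = bot⋢bot tt
¬⊏bot {x = emb _ _ _ _ _} (() , _)

-- On embedded subsets, _⊑_ unfolds to such pairs.
⊆×refines-antisym : {S S′ : Subset n} {R R′ : Rel n} →
                    S ⊆ S′ × Refines R R′ → S′ ⊆ S × Refines R′ R → S ≡ S′ × R ≡ R′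
⊆×refines-antisym (S⊆S′ , R⊑R′) (S′⊆S , R′⊑R) =
  ⊆-antisym S⊆S′ S′⊆S , refines-antisym R⊑R′ R′⊑R

atom : Fin n → Elem n
atom i = emb ⁅ i ⁆ (i , x∈⁅x⁆ i) discrete discrete-isPartition (discrete-block i)

-- Its argument only witnesses that N is nonempty.
top : Fin n → Elem n
top i = emb ⊤ (i , ∈⊤) indiscrete indiscrete-isPartition (indiscrete-block i)

⊑-top : (i : Fin n) (x : Elem n) → x ⊑ top i
⊑-top i bot             = tt
⊑-top i (emb _ _ _ _ _) = (λ _ → ∈⊤) , λ a c _ → ∼indiscrete a c

x∈p⇒⁅x⁆⊆p : {S : Subset n} {a : Fin n} → a ∈ S → ⁅ a ⁆ ⊆ S
x∈p⇒⁅x⁆⊆p {S = S} {a} a∈S b∈a = subst (_∈ S) (sym (x∈⁅y⁆⇒x≡y a b∈a)) a∈S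

nonempty∧⊆⁅x⁆⇒x∈ : {S : Subset n} {i : Fin n} → Nonempty S → S ⊆ ⁅ i ⁆ → i ∈ S
nonempty∧⊆⁅x⁆⇒x∈ {S = S} {i} (a , a∈S) S⊆i = subst (_∈ S) (x∈⁅y⁆⇒x≡y i (S⊆i a∈S)) a∈S

-- Covers

size : ∀ {m} → Vec (Subset n) m → ℕ
size = sum ∘ map ∣_∣

size-mono : ∀ {m} (ps qs : Vec (Subset n) m) → (∀ i → lookup ps i ⊆ lookup qs i) →
            size ps ≤ size qs
size-mono [] [] _ = z≤n
size-mono (p ∷ ps) (q ∷ qs) ps⊆qs =
  +-mono-≤ (p⊆q⇒∣p∣≤∣q∣ (ps⊆qs Fin.zero)) (size-mono ps qs (ps⊆qs ∘ Fin.suc))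

size-mono-< : ∀ {m} (ps qs : Vec (Subset n) m) → (∀ i → lookup ps i ⊆ lookup qs i) →
              (i : Fin m) → ¬ (lookup qs i ⊆ lookup ps i) → size ps < size qs
size-mono-< (p ∷ ps) (q ∷ qs) ps⊆qs Fin.zero q⊈p =
  +-mono-<-≤ (⊆∧⊈⇒∣∣< (ps⊆qs Fin.zero) q⊈p) (size-mono ps qs (ps⊆qs ∘ Fin.suc))
size-mono-< (p ∷ ps) (q ∷ qs) ps⊆qs (Fin.suc i) qᵢ⊈pᵢ =
  +-mono-≤-< (p⊆q⇒∣p∣≤∣q∣ (ps⊆qs Fin.zero))
             (size-mono-< ps qs (ps⊆qs ∘ Fin.suc) i qᵢ⊈pᵢ)

μ : Elem n → ℕ
μ bot             = 0
μ (emb S _ R _ _) = ℕ.suc (∣ S ∣ + size R)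

μ-mono-⊏ : {x y : Elem n} → x ⊏ y → μ x < μ y
μ-mono-⊏ {x = bot} {bot}           (_ , y⋢x) = contradiction tt y⋢x
μ-mono-⊏ {x = bot} {emb _ _ _ _ _} _         = s≤s z≤n
μ-mono-⊏ {x = emb S _ R _ _} {emb S′ _ R′ _ _} ((S⊆S′ , R⊑R′) , y⋢x) with S′ ⊆? S
... | no S′⊈S = s≤s (+-mono-<-≤ (⊆∧⊈⇒∣∣< S⊆S′ S′⊈S) (size-mono R R′ λ i → R⊑R′ i _))
... | yes S′⊆S with ¬refines⇒∃ {R = R′} {R} (y⋢x ∘ (S′⊆S ,_))
...   | i , _ , i∼′j , i≁j = s≤s (+-mono-≤-< (p⊆q⇒∣p∣≤∣q∣ S⊆S′)
          (size-mono-< R R′ (λ i → R⊑R′ i _) i λ row′⊆row → i≁j (row′⊆row i∼′j)))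

-- Induction on a bound k for μ x − μ z.
lowerCover-above : ∀ k {x z : Elem n} → μ x ≤ k + μ z → z ⊏ x →
                   ¬ ¬ (∃[ w ] (z ⊑ w × w ⋖ x))
lowerCover-above ℕ.zero {x} {z} μx≤μz z⊏x _ = <⇒≱ (μ-mono-⊏ z⊏x) μx≤μz
lowerCover-above (ℕ.suc k) {x} {z} μx≤k+1+μz z⊏x no-cover =
  no-cover (z , ⊑-refl z , z⊏x , λ z′ z⊏z′ z′⊏x →
    lowerCover-above k (μx≤k+μz′ z⊏z′) z′⊏x λ (w , z′⊑w , w⋖x) →
      no-cover (w , ⊑-trans (proj₁ z⊏z′) z′⊑w , w⋖x))
  where
  μx≤k+μz′ : ∀ {z′} → z ⊏ z′ → μ x ≤ k + μ z′
  μx≤k+μz′ {z′} z⊏z′ = begin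
    μ x             ≤⟨ μx≤k+1+μz ⟩
    ℕ.suc (k + μ z) ≡⟨ sym (+-suc k (μ z)) ⟩
    k + ℕ.suc (μ z) ≤⟨ +-monoʳ-≤ k (μ-mono-⊏ z⊏z′) ⟩
    k + μ z′        ∎
    where open ≤-Reasoning

upperCover-below : ∀ k {x z : Elem n} → μ z ≤ k + μ x → x ⊏ z →
                   ¬ ¬ (∃[ w ] (x ⋖ w × w ⊑ z))
upperCover-below ℕ.zero {x} {z} μz≤μx x⊏z _ = <⇒≱ (μ-mono-⊏ x⊏z) μz≤μx
upperCover-below (ℕ.suc k) {x} {z} μz≤k+1+μx x⊏z no-cover =
  no-cover (z , (x⊏z , λ z′ x⊏z′ z′⊏z →
    upperCover-below k (≤-pred (≤-trans (μ-mono-⊏ z′⊏z) μz≤k+1+μx)) x⊏z′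
      λ (w , x⋖w , w⊑z′) → no-cover (w , x⋖w , ⊑-trans w⊑z′ (proj₁ z′⊏z))) , ⊑-refl z)

IsGreatestBelow : Elem n → Elem n → Set
IsGreatestBelow {n} y x = y ⊏ x × (∀ (z : Elem n) → z ⊏ x → z ⊑ y)

IsLeastAbove : Elem n → Elem n → Set
IsLeastAbove {n} y x = x ⊏ y × (∀ (z : Elem n) → x ⊏ z → y ⊑ z)

joinIrreducible⇒∃greatestBelow : {x : Elem n} → JoinIrreducible x → ∃[ y ] IsGreatestBelow y x
joinIrreducible⇒∃greatestBelow {x = x} (y , (y⊏x , _) , unique) = y , y⊏x , λ z z⊏x →
  decidable-stable (z ⊑? y) λ z⋢y →
    lowerCover-above (μ x) (m≤m+n (μ x) (μ z)) z⊏x λ (w , z⊑w , w⋖x) →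
      z⋢y (⊑-trans z⊑w (proj₁ (unique w w⋖x)))

meetIrreducible⇒∃leastAbove : {x : Elem n} → MeetIrreducible x → ∃[ y ] IsLeastAbove y x
meetIrreducible⇒∃leastAbove {x = x} (y , (x⊏y , _) , unique) = y , x⊏y , λ z x⊏z →
  decidable-stable (y ⊑? z) λ y⋢z →
    upperCover-below (μ z) (m≤m+n (μ z) (μ x)) x⊏z λ (w , x⋖w , w⊑z) →
      y⋢z (⊑-trans (proj₂ (unique w x⋖w)) w⊑z)

isGreatestBelow⇒joinIrreducible : {x y : Elem n} → IsGreatestBelow y x → JoinIrreducible x
isGreatestBelow⇒joinIrreducible {y = y} (y⊏x , below⊑y) =
  y , (y⊏x , λ z (_ , z⋢y) z⊏x → z⋢y (below⊑y z z⊏x)) , λ y′ (y′⊏x , y′-cover) →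
    below⊑y y′ y′⊏x ,
    decidable-stable (y ⊑? y′) λ y⋢y′ → y′-cover y (below⊑y y′ y′⊏x , y⋢y′) y⊏x

isLeastAbove⇒meetIrreducible : {x y : Elem n} → IsLeastAbove y x → MeetIrreducible x
isLeastAbove⇒meetIrreducible {y = y} (x⊏y , y⊑above) =
  y , (x⊏y , λ z x⊏z (_ , y⋢z) → y⋢z (y⊑above z x⊏z)) , λ y′ (x⊏y′ , y′-cover) →
    decidable-stable (y′ ⊑? y) (λ y′⋢y → y′-cover y x⊏y (y⊑above y′ x⊏y′ , y′⋢y)) ,
    y⊑above y′ x⊏y′

-- Join-irreducible elements

isGreatestBelow⇒atomOrPairForm : {y : Elem n} (x : Elem n) → IsGreatestBelow y x →
                                 IsAtomForm x ⊎ IsPairForm x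
isGreatestBelow⇒atomOrPairForm bot (y⊏bot , _) = contradiction y⊏bot ¬⊏bot
isGreatestBelow⇒atomOrPairForm {n} x@(emb S (b , b∈S) R P B) y-greatest with x ⊑? atom b
... | yes x⊑b = inj₁ (b , ⊆×refines-antisym x⊑b (atom⊑x b∈S))
  where
  atom⊑x : ∀ {a} → a ∈ S → atom a ⊑ x
  atom⊑x a∈S = x∈p⇒⁅x⁆⊆p a∈S , discrete-refines P
... | no x⋢b  = inj₂ (notAtom⇒isPairForm y-greatest)
  where
  atom⊏x : ∀ {a} → a ∈ S → atom a ⊏ x
  atom⊏x {a} a∈S = (x∈p⇒⁅x⁆⊆p a∈S , discrete-refines P) , λ x⊑a →
    x⋢b (subst (λ c → x ⊑ atom c) (sym (x∈⁅y⁆⇒x≡y a (proj₁ x⊑a b∈S))) x⊑a)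

  notAtom⇒isPairForm : ∀ {y} → IsGreatestBelow y x → IsPairForm x
  notAtom⇒isPairForm {bot} (_ , below⊑y) = ⊥-elim (below⊑y (atom b) (atom⊏x b∈S))
  notAtom⇒isPairForm {emb S′ _ R′ P′ B′} ((_ , x⋢y) , below⊑y) =
    separated⇒isPairForm (¬refines⇒∃ {R = R} {R′} (x⋢y ∘ (S⊆S′ ,_)))
    where
    S⊆S′ : S ⊆ S′
    S⊆S′ {a} a∈S = proj₁ (below⊑y (atom a) (atom⊏x a∈S)) (x∈⁅x⁆ a)

    separated⇒isPairForm : (∃₂ λ i j → i ∼[ R ] j × ¬ (i ∼[ R′ ] j)) → IsPairForm x
    separated⇒isPairForm (i , j , i∼j , i≁′j) =
      b , i , j , (λ { refl → i≁′j (IsPartition.refl′ P′ i) }) , b≢i , b≢j ,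
      ⊆×refines-antisym x⊑b-ij b-ij⊑x
      where
      i∉S : i ∉ S
      i∉S i∈S = i≁′j (block-related P′ B′ (S⊆S′ i∈S) (S⊆S′ (block-saturated P B i∼j i∈S)))
      b≢i : b ≢ i
      b≢i refl = i∉S b∈S
      b≢j : b ≢ j
      b≢j refl = i∉S (block-saturated P B (IsPartition.sym′ P i b i∼j) b∈S)
      b-ij : Elem n
      b-ij = emb ⁅ b ⁆ (b , x∈⁅x⁆ b) (pairPart i j) (pairPart-isPartition i j)
                 (pairPart-block b≢i b≢j)
      b-ij⊑x : b-ij ⊑ x
      b-ij⊑x = x∈p⇒⁅x⁆⊆p b∈S , pairPart-least P i∼j
      x⊑b-ij : x ⊑ b-ij
      x⊑b-ij = decidable-stable (x ⊑? b-ij) λ x⋢b-ij →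
        i≁′j (proj₂ (below⊑y b-ij (b-ij⊑x , x⋢b-ij)) i j (j∼pairPartk i j))

atom-isGreatestBelow : ∀ {i : Fin n} {ne P B} → IsGreatestBelow bot (emb ⁅ i ⁆ ne discrete P B)
atom-isGreatestBelow {n} {i} {ne} {P} {B} = (tt , λ ()) , below⊑bot
  where
  below⊑bot : (z : Elem n) → z ⊏ emb ⁅ i ⁆ ne discrete P B → z ⊑ bot
  below⊑bot bot _ = tt
  below⊑bot (emb _ ne′ _ P′ _) ((S′⊆i , _) , x⋢z) =
    x⋢z (x∈p⇒⁅x⁆⊆p (nonempty∧⊆⁅x⁆⇒x∈ ne′ S′⊆i) , discrete-refines P′)

pair-isGreatestBelow : ∀ {i j k : Fin n} {ne P B} → j ≢ k →
                       IsGreatestBelow (atom i) (emb ⁅ i ⁆ ne (pairPart j k) P B)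
pair-isGreatestBelow {n} {i} {j} {k} {ne} {P} {B} j≢k = atom⊏x , below⊑atom
  where
  x : Elem n
  x = emb ⁅ i ⁆ ne (pairPart j k) P B

  atom⊏x : atom i ⊏ x
  atom⊏x = ((λ i∈ → i∈) , discrete-refines P) , λ (_ , jk⊑discrete) →
    j≢k (to ∼discrete⇔ (jk⊑discrete j k (j∼pairPartk j k)))

  below⊑atom : (z : Elem n) → z ⊏ x → z ⊑ atom i
  below⊑atom bot _ = tt
  below⊑atom (emb _ ne′ _ P′ _) ((S′⊆i , R′⊑jk) , x⋢z) with pairPart-atom P′ R′⊑jk
  ... | inj₁ R′⊑discrete = S′⊆i , R′⊑discrete
  ... | inj₂ jk⊑R′       = ⊥-elim (x⋢z (x∈p⇒⁅x⁆⊆p (nonempty∧⊆⁅x⁆⇒x∈ ne′ S′⊆i) , jk⊑R′))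

-- Meet-irreducible elements

¬isLeastAbove-bot : {y : Elem n} {i j : Fin n} → i ≢ j → ¬ IsLeastAbove y bot
¬isLeastAbove-bot {y = bot} _ ((_ , bot⋢bot) , _) = bot⋢bot tt
¬isLeastAbove-bot {y = emb _ (a , a∈S′) _ _ _} {i} {j} i≢j (_ , y⊑above) =
  i≢j (trans (sym (a≡ i)) (a≡ j))
  where
  a≡ : ∀ c → a ≡ c
  a≡ c = x∈⁅y⁆⇒x≡y c (proj₁ (y⊑above (atom c) (tt , λ ())) a∈S′)

split : {A : Subset n} {a : Fin n} → a ∈ A → Elem n
split {A = A} a∈A = emb A (_ , a∈A) (twoPart A) (twoPart-isPartition A) (twoPart-block a∈A)

∉∧∉⇒∼twoPart : {A : Subset n} {a b : Fin n} → a ∉ A → b ∉ A → a ∼[ twoPart A ] b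
∉∧∉⇒∼twoPart a∉A b∉A = from ∼twoPart⇔ (mk⇔ (⊥-elim ∘ a∉A) (⊥-elim ∘ b∉A))

⊑-full : ∀ {S ne R P B} → (∀ a → a ∈ S) → (z : Elem n) → z ⊑ emb S ne R P B
⊑-full all∈S bot = tt
⊑-full {P = P} {B} all∈S (emb _ _ _ _ _) =
  (λ {a} _ → all∈S a) , λ a c _ → block-related P B (all∈S a) (all∈S c)

threeBlocks⇒⊑ : ∀ {S ne R P B} {y : Elem n} {s t k : Fin n} →
                s ∈ S → t ∉ S → ¬ (k ∼[ R ] s) → ¬ (k ∼[ R ] t) →
                (∀ z → emb S ne R P B ⊏ z → y ⊑ z) → y ⊑ emb S ne R P B
threeBlocks⇒⊑ {y = bot} _ _ _ _ _ = tt
threeBlocks⇒⊑ {S = S} {R = R} {P} {B} {y@(emb _ _ R′ _ _)} {s} {t} {k} s∈S t∉S k≁s k≁t y⊑above =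
  proj₁ y⊑split-S , R′⊑R
  where
  open IsPartition P

  k∉S : k ∉ S
  k∉S k∈S = k≁s (block-related P B k∈S s∈S)

  ∉S⇒S⊆∁ : ∀ {a} → a ∉ S → S ⊆ ∁ (lookup R a)
  ∉S⇒S⊆∁ {a} a∉S c∈S = x∉p⇒x∈∁p λ a∼c → a∉S (block-saturated P B (sym′ a _ a∼c) c∈S)

  y⊑split-S : y ⊑ split s∈S
  y⊑split-S = y⊑above (split s∈S) (((λ c∈S → c∈S) , refines-twoPart P (block-saturated P B)) ,
    λ (_ , S-split⊑R) → k≁t (S-split⊑R k t (∉∧∉⇒∼twoPart k∉S t∉S)))

  y⊑split-∁ : ∀ {a} (a∉S : a ∉ S) → y ⊑ split (∉S⇒S⊆∁ a∉S s∈S)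
  y⊑split-∁ {a} a∉S = y⊑above (split (∉S⇒S⊆∁ a∉S s∈S))
    ((∉S⇒S⊆∁ a∉S , refines-twoPart P (∁-block-saturated P a)) , ∁⊈S ∘ proj₁)
    where
    ∁⊈S : ¬ (∁ (lookup R a) ⊆ S)
    ∁⊈S ∁⊆S with t ∈? lookup R a
    ... | yes a∼t = k∉S (∁⊆S (x∉p⇒x∈∁p λ a∼k → k≁t (trans′ k a t (sym′ a k a∼k) a∼t)))
    ... | no a≁t  = t∉S (∁⊆S (x∉p⇒x∈∁p a≁t))

  R′⊑R : Refines R′ R
  R′⊑R a c a∼′c with a ∈? S
  ... | yes a∈S = block-related P B a∈S (to (to ∼twoPart⇔ (proj₂ y⊑split-S a c a∼′c)) a∈S)
  ... | no a∉S  = x∉∁p⇒x∈p λ c∈∁ →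
    x∈∁p⇒x∉p (from (to ∼twoPart⇔ (proj₂ (y⊑split-∁ a∉S) a c a∼′c)) c∈∁) (refl′ a)

twoPartition⊎thirdBlock : (R : Rel n) {s t : Fin n} → ¬ (s ∼[ R ] t) →
                          TwoPartition R ⊎ ∃[ k ] (¬ (k ∼[ R ] s) × ¬ (k ∼[ R ] t))
twoPartition⊎thirdBlock {n} R {s} {t} s≁t = classify (all? related?)
  where
  related? : ∀ k → Dec (k ∼[ R ] s ⊎ k ∼[ R ] t)
  related? k = (s ∈? lookup R k) ⊎-dec (t ∈? lookup R k)

  classify : Dec (∀ k → k ∼[ R ] s ⊎ k ∼[ R ] t) →
             TwoPartition R ⊎ ∃[ k ] (¬ (k ∼[ R ] s) × ¬ (k ∼[ R ] t))
  classify (yes covered) = inj₁ (s , t , s≁t , covered)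
  classify (no ¬covered) =
    inj₂ (Prod.map₂ (λ k≁s⊎t → k≁s⊎t ∘ inj₁ , k≁s⊎t ∘ inj₂) (¬∀⟶∃¬ n _ related? ¬covered))

isLeastAbove⇒twoPartition : ∀ {S ne R P B} {y : Elem n} →
                            IsLeastAbove y (emb S ne R P B) → TwoPartition R
isLeastAbove⇒twoPartition {n} {S} {s , s∈S} {R} {P} {B} {y} ((_ , y⋢x) , y⊑above)
  with all? (_∈? S)
... | yes all∈S = contradiction (⊑-full all∈S y) y⋢x
... | no ¬all∈S with ¬∀⟶∃¬ n (_∈ S) (_∈? S) ¬all∈S
...   | t , t∉S with twoPartition⊎thirdBlock R (λ s∼t → t∉S (block-saturated P B s∼t s∈S))
...     | inj₁ R-two           = R-two
...     | inj₂ (k , k≁s , k≁t) = contradiction (threeBlocks⇒⊑ s∈S t∉S k≁s k≁t y⊑above) y⋢x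

twoPartition-isLeastAbove-top : ∀ {S s s∈S R P B} → TwoPartition R →
                                IsLeastAbove (top s) (emb {n} S (s , s∈S) R P B)
twoPartition-isLeastAbove-top {n} {S} {s} {s∈S} {R} {P} {B} R-two@(i , j , i≁j , _) =
  (⊑-top s x , top⋢x) , top⊑above
  where
  x : Elem n
  x = emb S (s , s∈S) R P B

  top⋢x : ¬ (top s ⊑ x)
  top⋢x (_ , indiscrete⊑R) = i≁j (indiscrete⊑R i j (∼indiscrete i j))

  top⊑above : (z : Elem n) → x ⊏ z → top s ⊑ z
  top⊑above (emb S′ _ _ P′ B′) ((S⊆S′ , R⊑R′) , z⋢x) with twoPartition-coatom P P′ R-two R⊑R′
  ... | inj₁ R′⊑R  = ⊥-elim (z⋢x (S′⊆S , R′⊑R))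
    where
    S′⊆S : S′ ⊆ S
    S′⊆S c∈S′ = block-saturated P B (R′⊑R s _ (block-related P′ B′ (S⊆S′ s∈S) c∈S′)) s∈S
  ... | inj₂ all∼′ = (λ {c} _ → block-saturated P′ B′ (all∼′ s c) (S⊆S′ s∈S)) , λ a c _ → all∼′ a c

distinctPair : 1 < n → ∃₂ λ (i j : Fin n) → i ≢ j
distinctPair {ℕ.suc (ℕ.suc _)} _ = Fin.zero , Fin.suc Fin.zero , λ ()
distinctPair {ℕ.suc ℕ.zero} (s≤s ())

joinIrreducible⇒atomOrPairForm : (x : Elem n) → JoinIrreducible x → IsAtomForm x ⊎ IsPairForm x
joinIrreducible⇒atomOrPairForm x =
  isGreatestBelow⇒atomOrPairForm x ∘ proj₂ ∘ joinIrreducible⇒∃greatestBelow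

atomOrPairForm⇒joinIrreducible : (x : Elem n) → IsAtomForm x ⊎ IsPairForm x → JoinIrreducible x
atomOrPairForm⇒joinIrreducible (emb _ _ _ _ _) (inj₁ (_ , refl , refl)) =
  isGreatestBelow⇒joinIrreducible atom-isGreatestBelow
atomOrPairForm⇒joinIrreducible (emb _ _ _ _ _) (inj₂ (_ , _ , _ , j≢k , _ , _ , refl , refl)) =
  isGreatestBelow⇒joinIrreducible (pair-isGreatestBelow j≢k)

meetIrreducible⇒twoPartForm : 1 < n → (x : Elem n) → MeetIrreducible x → IsTwoPartForm x
meetIrreducible⇒twoPartForm 1<n bot mi =
  let _ , _ , i≢j = distinctPair 1<n
  in  ¬isLeastAbove-bot i≢j (proj₂ (meetIrreducible⇒∃leastAbove mi))
meetIrreducible⇒twoPartForm _ (emb _ _ _ _ _) =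
  isLeastAbove⇒twoPartition ∘ proj₂ ∘ meetIrreducible⇒∃leastAbove

twoPartForm⇒meetIrreducible : (x : Elem n) → IsTwoPartForm x → MeetIrreducible x
twoPartForm⇒meetIrreducible (emb _ _ _ _ _) =
  isLeastAbove⇒meetIrreducible ∘ twoPartition-isLeastAbove-top

proposition2 : (n : ℕ) → 2 < n →
    ((x : Elem n) → (JoinIrreducible x → IsAtomForm x ⊎ IsPairForm x)
                  × (IsAtomForm x ⊎ IsPairForm x → JoinIrreducible x))
    × ((x : Elem n) → (MeetIrreducible x → IsTwoPartForm x)
                    × (IsTwoPartForm x → MeetIrreducible x))
proposition2 n 2<n =
  (λ x → joinIrreducible⇒atomOrPairForm x , atomOrPairForm⇒joinIrreducible x) ,
  (λ x → meetIrreducible⇒twoPartForm (<-trans (n<1+n 1) 2<n) x , twoPartForm⇒meetIrreducible x)
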